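{- Let $\mathbf{N}$ denote the set of positive integers and $\mathbf{Q}$ the set of rational numbers. Let $S = \mathcal{I} \cap \mathbf{Q}$, where $\mathcal{I} \subseteq \mathbf{R}$ is an interval (open, closed, or half-open) with nonempty interior. If $f:\mathbf{N} \rightarrow S$ is surjective, then for no positive integer $k$ is $f$ $k$-monotonic; that is, for every positive integer $k$ there do not exist subsets $X_1, \ldots, X_k \subseteq \mathbf{N}$ with $\mathbf{N} = X_1 \cup \cdots \cup X_k$ such that for each $i$ the restriction $f|X_i$ is monotonically increasing or monotonically decreasing.
   Context: A function $g: A \rightarrow B$ between ordered sets is monotonically increasing if $x \leq x'$ implies $g(x) \leq g(x')$, and monotonically decreasing if $x \leq x'$ implies $g(x) \geq g(x')$. The function $f$ is called $k$-monotonic if its domain is a union of $k$ subsets on each of which $f$ is monotonically increasing or monotonically decreasing. -}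

module Defs where

open import Data.Nat using (ℕ) renaming (_≤_ to _≤ℕ_)
open import Data.Fin using (Fin)
open import Data.Rational using (ℚ; _≤_; _<_)
open import Data.Product using (Σ; ∃; _×_)
open import Data.Sum using (_⊎_)
open import Relation.Binary.PropositionalEquality using (_≡_)

Pos : ℕ → Set
Pos n = 1 ≤ℕ n

-- A subset of ℚ of the form  I ∩ ℚ  for a real interval I with nonempty
-- interior.  Since ℝ is unavailable, such sets are described intrinsically:
-- order-convex subsets of ℚ containing two distinct points (equivalent by
-- completeness of ℝ: take I with endpoints inf S, sup S in the extended reals).
IsOrdConvex : (ℚ → Set) → Set
IsOrdConvex S = ∀ a b c → S a → S c → a ≤ b → b ≤ c → S b

IsRatIntervalWithInterior : (ℚ → Set) → Set
IsRatIntervalWithInterior S =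
  IsOrdConvex S × (Σ ℚ λ a → Σ ℚ λ b → a < b × S a × S b)

IsSurjOnto : (ℕ → ℚ) → (ℚ → Set) → Set
IsSurjOnto f S =
  (∀ n → Pos n → S (f n)) × (∀ q → S q → Σ ℕ λ n → Pos n × f n ≡ q)

MonoIncOn : (ℕ → ℚ) → (ℕ → Set) → Set
MonoIncOn f X = ∀ m n → X m → X n → m ≤ℕ n → f m ≤ f n

MonoDecOn : (ℕ → ℚ) → (ℕ → Set) → Set
MonoDecOn f X = ∀ m n → X m → X n → m ≤ℕ n → f n ≤ f m

KMonotonic : ℕ → (ℕ → ℚ) → Set₁
KMonotonic k f =
  Σ (Fin k → ℕ → Set) λ X →
    (∀ i n → X i n → Pos n) ×
    (∀ n → Pos n → ∃ λ i → X i n) ×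
    (∀ i → MonoIncOn f (X i) ⊎ MonoDecOn f (X i))

{-# OPTIONS --safe #-}
module Submission where

open import Defs
open import Data.Nat using (ℕ; _≤_)
open import Data.Rational using (ℚ)
open import Relation.Nullary using (¬_)

open import Data.Nat using (zero; suc; _<_)
import Data.Nat.Properties as ℕ
open import Data.Nat.Induction using (<-wellFounded)
import Data.Rational as ℚ
import Data.Rational.Properties as ℚ
open import Data.Empty using (⊥)
open import Data.Fin using (Fin; _≟_)
open import Data.List using (List; length; filter; allFin)
open import Data.List.Membership.Propositional using (_∈_)
open import Data.List.Membership.Propositional.Properties using (∈-filter⁺; ∈-allFin)
open import Data.List.Properties using (filter-notAll)
import Data.List.Relation.Unary.Any as Any
open import Data.Product using (∃₂; _×_; _,_)
open import Data.Sum using (_⊎_; inj₁; inj₂)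
open import Function using (_on_)
open import Induction.WellFounded using (Acc; acc)
open import Relation.Binary.Construct.On using (wellFounded)
open import Relation.Binary.PropositionalEquality using (_≡_; refl; sym)
open import Relation.Nullary using (yes; no; ¬?; _×-dec_)

-- If f is covered by monotone pieces, every value c = f n taken in an open
-- window of S lets us shrink the window so that the piece through n misses it:
-- on an increasing piece the later values are ≥ c, so they miss (a , c), and the
-- finitely many earlier values f 0 , … , f (n - 1) can be avoided by a further
-- subwindow (dually for a decreasing piece).  The subwindow still lies in S, so
-- its points are still values of f.  After as many steps as there are pieces,
-- a nonempty window is missed by every piece, which is absurd.

infix 4 _∈⟨_,_⟩

_∈⟨_,_⟩ : ℚ → ℚ → ℚ → Set
x ∈⟨ a , b ⟩ = a ℚ.< x × x ℚ.< b

∈⟨⟩-widen : ∀ {x a b a′ b′} → a ℚ.≤ a′ → b′ ℚ.≤ b → x ∈⟨ a′ , b′ ⟩ → x ∈⟨ a , b ⟩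
∈⟨⟩-widen a≤a′ b′≤b (a′<x , x<b′) = ℚ.≤-<-trans a≤a′ a′<x , ℚ.<-≤-trans x<b′ b′≤b

Misses : (ℕ → ℚ) → (ℕ → Set) → ℚ → ℚ → Set
Misses g I a b = ∀ j → I j → ¬ g j ∈⟨ a , b ⟩

Misses-shrink : ∀ {g I a b a′ b′} → a ℚ.≤ a′ → b′ ℚ.≤ b → Misses g I a b → Misses g I a′ b′
Misses-shrink a≤a′ b′≤b misses j Ij gj∈ = misses j Ij (∈⟨⟩-widen a≤a′ b′≤b gj∈)

record Subwindow (a b : ℚ) (P : ℚ → ℚ → Set) : Set where
  constructor subwindow
  field
    lo hi : ℚ
    a≤lo  : a ℚ.≤ lo
    lo<hi : lo ℚ.< hi
    hi≤b  : hi ℚ.≤ b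
    has   : P lo hi

Misses-suc : ∀ {g n a b} → Misses g (_< n) a b → ¬ g n ∈⟨ a , b ⟩ → Misses g (_< suc n) a b
Misses-suc misses gn∉ j j<1+n with ℕ.m<1+n⇒m<n∨m≡n j<1+n
... | inj₁ j<n  = misses j j<n
... | inj₂ refl = gn∉

finite-misses : ∀ (g : ℕ → ℚ) n {a b} → a ℚ.< b → Subwindow a b (Misses g (_< n))
finite-misses g zero a<b = subwindow _ _ ℚ.≤-refl a<b ℚ.≤-refl (λ _ ())
finite-misses g (suc n) a<b with finite-misses g n a<b
... | subwindow lo hi a≤lo lo<hi hi≤b misses with lo ℚ.<? g n ×-dec g n ℚ.<? hi
...   | no gn∉ = subwindow lo hi a≤lo lo<hi hi≤b (Misses-suc misses gn∉)
...   | yes (lo<gn , gn<hi) =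
  subwindow lo (g n) a≤lo lo<gn (ℚ.≤-trans (ℚ.<⇒≤ gn<hi) hi≤b)
    (Misses-suc (Misses-shrink ℚ.≤-refl (ℚ.<⇒≤ gn<hi) misses) λ (_ , gn<gn) → ℚ.<-irrefl refl gn<gn)

module _ {f : ℕ → ℚ} {X : ℕ → Set} where

  monotone-tail-misses : MonoIncOn f X ⊎ MonoDecOn f X → ∀ {n a b} → X n → f n ∈⟨ a , b ⟩ →
                         Subwindow a b (Misses f (λ m → X m × n ≤ m))
  monotone-tail-misses (inj₁ inc) {n} Xn (a<fn , fn<b) =
    subwindow _ (f n) ℚ.≤-refl a<fn (ℚ.<⇒≤ fn<b)
      λ m (Xm , n≤m) (_ , fm<fn) → ℚ.<-irrefl refl (ℚ.≤-<-trans (inc n m Xn Xm n≤m) fm<fn)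
  monotone-tail-misses (inj₂ dec) {n} Xn (a<fn , fn<b) =
    subwindow (f n) _ (ℚ.<⇒≤ a<fn) fn<b ℚ.≤-refl
      λ m (Xm , n≤m) (fn<fm , _) → ℚ.<-irrefl refl (ℚ.<-≤-trans fn<fm (dec n m Xn Xm n≤m))

  monotone-piece-misses : MonoIncOn f X ⊎ MonoDecOn f X → ∀ {n a b} → X n → f n ∈⟨ a , b ⟩ →
                          Subwindow a b (Misses f X)
  monotone-piece-misses mono {n} Xn fn∈ with monotone-tail-misses mono Xn fn∈
  ... | subwindow l u a≤l l<u u≤b tail with finite-misses f n l<u
  ...   | subwindow lo hi l≤lo lo<hi hi≤u head =
    subwindow lo hi (ℚ.≤-trans a≤l l≤lo) lo<hi (ℚ.≤-trans hi≤u u≤b) misses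
    where
    misses : Misses f X lo hi
    misses m Xm with ℕ.<-≤-connex m n
    ... | inj₁ m<n = head m m<n
    ... | inj₂ n≤m = Misses-shrink l≤lo hi≤u tail m (Xm , n≤m)

module _ {k} (f : ℕ → ℚ) (X : Fin k → ℕ → Set) where

  Attained : ℚ → ℚ → Set
  Attained a b = ∀ {x} → x ∈⟨ a , b ⟩ → ∃₂ λ i n → X i n × f n ≡ x

  PiecesMeeting⊆ : List (Fin k) → ℚ → ℚ → Set
  PiecesMeeting⊆ R a b = ∀ i m → X i m → f m ∈⟨ a , b ⟩ → i ∈ R

  module _ {a b lo hi} (a≤lo : a ℚ.≤ lo) (hi≤b : hi ℚ.≤ b) where

    Attained-shrink : Attained a b → Attained lo hi
    Attained-shrink attained x∈ = attained (∈⟨⟩-widen a≤lo hi≤b x∈)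

    PiecesMeeting⊆-drop : ∀ {R i} → PiecesMeeting⊆ R a b → Misses f (X i) lo hi →
                          PiecesMeeting⊆ (filter (λ j → ¬? (j ≟ i)) R) lo hi
    PiecesMeeting⊆-drop within misses j m Xjm fm∈ =
      ∈-filter⁺ _ (within j m Xjm (∈⟨⟩-widen a≤lo hi≤b fm∈)) λ { refl → misses m Xjm fm∈ }

  drop-shortens : ∀ {R} {i : Fin k} → i ∈ R → length (filter (λ j → ¬? (j ≟ i)) R) < length R
  drop-shortens {R} i∈R = filter-notAll _ R (Any.map (λ i≡j j≢i → j≢i (sym i≡j)) i∈R)

  monotone-pieces-attain-no-window : (∀ i → MonoIncOn f (X i) ⊎ MonoDecOn f (X i)) →
                                      ∀ {a b} → a ℚ.< b → ¬ Attained a b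
  monotone-pieces-attain-no-window mono a<b attained =
    go _ (wellFounded length <-wellFounded (allFin k)) a<b attained (λ i _ _ _ → ∈-allFin i)
    where
    go : ∀ R → Acc (_<_ on length) R → ∀ {a b} → a ℚ.< b → Attained a b → PiecesMeeting⊆ R a b → ⊥
    go R (acc shorter) a<b attained within with ℚ.<-dense a<b
    ... | c , c∈ with attained c∈
    ...   | i , n , Xin , refl with monotone-piece-misses (mono i) Xin c∈
    ...     | subwindow lo hi a≤lo lo<hi hi≤b misses =
      go _ (shorter (drop-shortens (within i n Xin c∈))) lo<hi
        (Attained-shrink a≤lo hi≤b attained) (PiecesMeeting⊆-drop a≤lo hi≤b within misses)

theorem3 : (S : ℚ → Set) → IsRatIntervalWithInterior S →
    (f : ℕ → ℚ) → IsSurjOnto f S →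
    (k : ℕ) → 1 ≤ k → ¬ KMonotonic k f
theorem3 S (convex , a , b , a<b , Sa , Sb) f (_ , onto) k _ (X , _ , cover , mono) =
  monotone-pieces-attain-no-window f X mono a<b attained
  where
  attained : Attained f X a b
  attained {x} (a<x , x<b) with onto x (convex a x b Sa Sb (ℚ.<⇒≤ a<x) (ℚ.<⇒≤ x<b))
  ... | n , pos-n , fn≡x with cover n pos-n
  ...   | i , Xin = i , n , Xin , fn≡x
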